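{- Let $p,q$ be distinct propositional letters and $\alpha:=p\to(q\looparrowright p)$. The logic $\mathcal{F}\alpha$ (the least logic containing $\alpha$) is Epstein incomplete: there is no set $X$ of Epstein relations with $\mathcal{F}\alpha=\{\varphi:X\vDash\varphi\}$.
   Context: Let $\Phi=\{p_0,p_1,\dots\}$ be a countably infinite set of propositional letters; $\mathsf{FOR}$ is the set of formulas built from $\Phi$ with $\neg$ and binary $\lor,\wedge,\to,\leftrightarrow,\vartriangle,\looparrowright$. An Epstein model is $\langle v,\mathfrak{R}\rangle$ with $v:\Phi\to\{0,1\}$ and $\mathfrak{R}\subseteq\mathsf{FOR}^2$ (an Epstein relation). Truth: $\langle v,\mathfrak{R}\rangle\vDash p$ iff $v(p)=1$; classical clauses for $\neg,\wedge,\lor,\to,\leftrightarrow$; $\vDash\psi\vartriangle\chi$ iff both $\psi,\chi$ true and $\langle\psi,\chi\rangle\in\mathfrak{R}$; $\vDash\psi\looparrowright\chi$ iff ($\psi$ false or $\chi$ true) and $\langle\psi,\chi\rangle\in\mathfrak{R}$. $\mathfrak{R}\vDash\varphi$ iff $\langle v,\mathfrak{R}\rangle\vDash\varphi$ for every $v$; $X\vDash\varphi$ iff $\mathfrak{R}\vDash\varphi$ for all $\mathfrak{R}\in X$. A substitution is an endomorphism of the formula algebra. $\mathcal{F}$ is the least set of formulas containing all classical tautologies, $(p\looparrowright q)\to(p\to q)$ and $(p\vartriangle q)\leftrightarrow((p\looparrowright q)\wedge(p\wedge q))$, closed under uniform substitution and modus ponens. For $\Lambda\subseteq\mathsf{FOR}$,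 $\mathcal{F}\Lambda$ is the least set containing $\mathcal{F}\cup\Lambda$ closed under uniform substitution and modus ponens; $\mathcal{F}\varphi:=\mathcal{F}\{\varphi\}$. A logic (set containing $\mathcal{F}$ closed under substitution and MP) $\lambda$ is Epstein complete iff $\lambda=\{\varphi:X\vDash\varphi\}$ for some set $X$ of Epstein relations; otherwise Epstein incomplete. -}

module Defs where

open import Data.Nat using (ℕ)
open import Data.Bool using (Bool; true; false; not; _∧_; _∨_)
open import Data.Product using (Σ; _×_)
open import Relation.Binary.PropositionalEquality using (_≡_)

infixr 5 _⇒_ _⇔_
infixl 6 _∨'_
infixl 7 _∧'_
data Formula : Set where
  var   : ℕ → Formula
  ¬'_   : Formula → Formula
  _∨'_  : Formula → Formula → Formula
  _∧'_  : Formula → Formula → Formula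
  _⇒_   : Formula → Formula → Formula
  _⇔_   : Formula → Formula → Formula
  _△_   : Formula → Formula → Formula
  _↬_   : Formula → Formula → Formula

subst : (ℕ → Formula) → Formula → Formula
subst σ (var i)  = σ i
subst σ (¬' a)   = ¬' subst σ a
subst σ (a ∨' b) = subst σ a ∨' subst σ b
subst σ (a ∧' b) = subst σ a ∧' subst σ b
subst σ (a ⇒ b)  = subst σ a ⇒ subst σ b
subst σ (a ⇔ b)  = subst σ a ⇔ subst σ b
subst σ (a △ b)  = subst σ a △ subst σ b
subst σ (a ↬ b)  = subst σ a ↬ subst σ b

_⇔ᵇ_ : Bool → Bool → Bool
true  ⇔ᵇ b = b
false ⇔ᵇ b = not b

Valuation : Set
Valuation = ℕ → Bool

EpsteinRelation : Set
EpsteinRelation = Formula → Formula → Bool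

⟦_⟧ : Formula → Valuation → EpsteinRelation → Bool
⟦ var i  ⟧ v ℜ = v i
⟦ ¬' a   ⟧ v ℜ = not (⟦ a ⟧ v ℜ)
⟦ a ∨' b ⟧ v ℜ = ⟦ a ⟧ v ℜ ∨ ⟦ b ⟧ v ℜ
⟦ a ∧' b ⟧ v ℜ = ⟦ a ⟧ v ℜ ∧ ⟦ b ⟧ v ℜ
⟦ a ⇒ b  ⟧ v ℜ = not (⟦ a ⟧ v ℜ) ∨ ⟦ b ⟧ v ℜ
⟦ a ⇔ b  ⟧ v ℜ = ⟦ a ⟧ v ℜ ⇔ᵇ ⟦ b ⟧ v ℜ
⟦ a △ b  ⟧ v ℜ = (⟦ a ⟧ v ℜ ∧ ⟦ b ⟧ v ℜ) ∧ ℜ a b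
⟦ a ↬ b  ⟧ v ℜ = (not (⟦ a ⟧ v ℜ) ∨ ⟦ b ⟧ v ℜ) ∧ ℜ a b

_,_⊨_ : Valuation → EpsteinRelation → Formula → Set
v , ℜ ⊨ φ = ⟦ φ ⟧ v ℜ ≡ true

_⊨ᴿ_ : EpsteinRelation → Formula → Set
ℜ ⊨ᴿ φ = ∀ (v : Valuation) → v , ℜ ⊨ φ

RelSet : Set₁
RelSet = EpsteinRelation → Set

_⊨ˣ_ : RelSet → Formula → Set
X ⊨ˣ φ = ∀ ℜ → X ℜ → ℜ ⊨ᴿ φ

data Classical : Formula → Set where
  c-var : ∀ i → Classical (var i)
  c-¬   : ∀ {a} → Classical a → Classical (¬' a)
  c-∨   : ∀ {a b} → Classical a → Classical b → Classical (a ∨' b)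
  c-∧   : ∀ {a b} → Classical a → Classical b → Classical (a ∧' b)
  c-⇒   : ∀ {a b} → Classical a → Classical b → Classical (a ⇒ b)
  c-⇔   : ∀ {a b} → Classical a → Classical b → Classical (a ⇔ b)

-- Classical tautologies (in the classical fragment; instances arise via substitution closure).
-- For classical formulas ⟦_⟧ does not depend on ℜ; we fix ℜ to be empty.
emptyRel : EpsteinRelation
emptyRel _ _ = false

ClassicalTautology : Formula → Set
ClassicalTautology φ = Classical φ × (∀ (v : Valuation) → v , emptyRel ⊨ φ)

p₀ p₁ : Formula
p₀ = var 0
p₁ = var 1

data 𝓕[_] (Λ : Formula → Set) : Formula → Set where
  taut  : ∀ {φ} → ClassicalTautology φ → 𝓕[ Λ ] φ
  ax↬   : 𝓕[ Λ ] ((p₀ ↬ p₁) ⇒ (p₀ ⇒ p₁))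
  ax△   : 𝓕[ Λ ] ((p₀ △ p₁) ⇔ ((p₀ ↬ p₁) ∧' (p₀ ∧' p₁)))
  hyp   : ∀ {φ} → Λ φ → 𝓕[ Λ ] φ
  usub  : ∀ {φ} (σ : ℕ → Formula) → 𝓕[ Λ ] φ → 𝓕[ Λ ] (subst σ φ)
  mp    : ∀ {φ ψ} → 𝓕[ Λ ] φ → 𝓕[ Λ ] (φ ⇒ ψ) → 𝓕[ Λ ] ψ

𝓕⟨_⟩ : Formula → Formula → Set
𝓕⟨ α ⟩ = 𝓕[ (λ ψ → ψ ≡ α) ]

EpsteinComplete : (Formula → Set) → Set₁
EpsteinComplete L = Σ RelSet (λ X → ∀ φ → (L φ → X ⊨ˣ φ) × (X ⊨ˣ φ → L φ))

-- Read ψ ↬ χ as χ (and ψ △ χ as ψ ∧ χ). Under this reading 𝓕's axioms and α become classical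
-- tautologies, so every theorem of 𝓕α is a tautology of the reading. On the other hand α, being
-- true under the all-true valuation, forces ⟨q, p⟩ ∈ ℜ in every Epstein relation validating it,
-- so (q → p) → (q ↬ p) is valid in any X complete for 𝓕α. Its reading (q → p) → p is refuted
-- by the all-false valuation.
module Submission where

open import Defs
open import Data.Nat using (ℕ)
open import Data.Bool using (Bool; true; false; not; _∧_; _∨_)
open import Data.Product using (_,_; proj₁; proj₂)
open import Relation.Nullary using (¬_)
open import Relation.Binary.PropositionalEquality using (_≢_; _≡_; refl; cong; cong₂; trans)

⟦_⟧ᶜ : Formula → Valuation → Bool
⟦ var i  ⟧ᶜ v = v i
⟦ ¬' a   ⟧ᶜ v = not (⟦ a ⟧ᶜ v)
⟦ a ∨' b ⟧ᶜ v = ⟦ a ⟧ᶜ v ∨ ⟦ b ⟧ᶜ v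
⟦ a ∧' b ⟧ᶜ v = ⟦ a ⟧ᶜ v ∧ ⟦ b ⟧ᶜ v
⟦ a ⇒ b  ⟧ᶜ v = not (⟦ a ⟧ᶜ v) ∨ ⟦ b ⟧ᶜ v
⟦ a ⇔ b  ⟧ᶜ v = ⟦ a ⟧ᶜ v ⇔ᵇ ⟦ b ⟧ᶜ v
⟦ a △ b  ⟧ᶜ v = ⟦ a ⟧ᶜ v ∧ ⟦ b ⟧ᶜ v
⟦ a ↬ b  ⟧ᶜ v = ⟦ b ⟧ᶜ v

Tautologyᶜ : Formula → Set
Tautologyᶜ φ = ∀ v → ⟦ φ ⟧ᶜ v ≡ true

⟦subst⟧ᶜ : ∀ σ φ v → ⟦ subst σ φ ⟧ᶜ v ≡ ⟦ φ ⟧ᶜ (λ i → ⟦ σ i ⟧ᶜ v)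
⟦subst⟧ᶜ σ (var i)  v = refl
⟦subst⟧ᶜ σ (¬' a)   v = cong not (⟦subst⟧ᶜ σ a v)
⟦subst⟧ᶜ σ (a ∨' b) v = cong₂ _∨_ (⟦subst⟧ᶜ σ a v) (⟦subst⟧ᶜ σ b v)
⟦subst⟧ᶜ σ (a ∧' b) v = cong₂ _∧_ (⟦subst⟧ᶜ σ a v) (⟦subst⟧ᶜ σ b v)
⟦subst⟧ᶜ σ (a ⇒ b)  v = cong₂ (λ x y → not x ∨ y) (⟦subst⟧ᶜ σ a v) (⟦subst⟧ᶜ σ b v)
⟦subst⟧ᶜ σ (a ⇔ b)  v = cong₂ _⇔ᵇ_ (⟦subst⟧ᶜ σ a v) (⟦subst⟧ᶜ σ b v)
⟦subst⟧ᶜ σ (a △ b)  v = cong₂ _∧_ (⟦subst⟧ᶜ σ a v) (⟦subst⟧ᶜ σ b v)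
⟦subst⟧ᶜ σ (a ↬ b)  v = ⟦subst⟧ᶜ σ b v

⟦⟧ᶜ-classical : ∀ {φ} → Classical φ → ∀ v → ⟦ φ ⟧ᶜ v ≡ ⟦ φ ⟧ v emptyRel
⟦⟧ᶜ-classical (c-var i) v = refl
⟦⟧ᶜ-classical (c-¬ a)   v = cong not (⟦⟧ᶜ-classical a v)
⟦⟧ᶜ-classical (c-∨ a b) v = cong₂ _∨_ (⟦⟧ᶜ-classical a v) (⟦⟧ᶜ-classical b v)
⟦⟧ᶜ-classical (c-∧ a b) v = cong₂ _∧_ (⟦⟧ᶜ-classical a v) (⟦⟧ᶜ-classical b v)
⟦⟧ᶜ-classical (c-⇒ a b) v = cong₂ (λ x y → not x ∨ y) (⟦⟧ᶜ-classical a v) (⟦⟧ᶜ-classical b v)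
⟦⟧ᶜ-classical (c-⇔ a b) v = cong₂ _⇔ᵇ_ (⟦⟧ᶜ-classical a v) (⟦⟧ᶜ-classical b v)

modus-ponensᵇ : ∀ {x y} → x ≡ true → (not x ∨ y) ≡ true → y ≡ true
modus-ponensᵇ {true} refl x⇒y = x⇒y

ax↬-tautologyᶜ : Tautologyᶜ ((p₀ ↬ p₁) ⇒ (p₀ ⇒ p₁))
ax↬-tautologyᶜ v with v 0 | v 1
... | true  | true  = refl
... | true  | false = refl
... | false | true  = refl
... | false | false = refl

ax△-tautologyᶜ : Tautologyᶜ ((p₀ △ p₁) ⇔ ((p₀ ↬ p₁) ∧' (p₀ ∧' p₁)))
ax△-tautologyᶜ v with v 0 | v 1
... | true  | true  = refl
... | true  | false = refl
... | false | true  = refl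
... | false | false = refl

𝓕-sound-ᶜ : ∀ {Λ} → (∀ {ψ} → Λ ψ → Tautologyᶜ ψ) → ∀ {φ} → 𝓕[ Λ ] φ → Tautologyᶜ φ
𝓕-sound-ᶜ Λ-taut (taut (c , t)) v = trans (⟦⟧ᶜ-classical c v) (t v)
𝓕-sound-ᶜ Λ-taut ax↬            v = ax↬-tautologyᶜ v
𝓕-sound-ᶜ Λ-taut ax△            v = ax△-tautologyᶜ v
𝓕-sound-ᶜ Λ-taut (hyp h)        v = Λ-taut h v
𝓕-sound-ᶜ Λ-taut (usub {φ} σ d) v =
  trans (⟦subst⟧ᶜ σ φ v) (𝓕-sound-ᶜ Λ-taut d (λ i → ⟦ σ i ⟧ᶜ v))
𝓕-sound-ᶜ Λ-taut (mp d e)       v = modus-ponensᵇ (𝓕-sound-ᶜ Λ-taut d v) (𝓕-sound-ᶜ Λ-taut e v)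

α-tautologyᶜ : ∀ p q → Tautologyᶜ (var p ⇒ (var q ↬ var p))
α-tautologyᶜ p q v with v p
... | true  = refl
... | false = refl

⊨α⇒related : ∀ {p q} ℜ → ℜ ⊨ᴿ (var p ⇒ (var q ↬ var p)) → ℜ (var q) (var p) ≡ true
⊨α⇒related {p} {q} ℜ ⊨α with ℜ (var q) (var p) | ⊨α (λ _ → true)
... | true  | _  = refl
... | false | ()

related⇒⊨ : ∀ a b ℜ → ℜ b a ≡ true → ℜ ⊨ᴿ ((b ⇒ a) ⇒ (b ↬ a))
related⇒⊨ a b ℜ related v rewrite related with not (⟦ b ⟧ v ℜ) ∨ ⟦ a ⟧ v ℜ
... | true  = refl
... | false = refl

¬tautologyᶜ-φ : ∀ p q → ¬ Tautologyᶜ ((var q ⇒ var p) ⇒ (var q ↬ var p))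
¬tautologyᶜ-φ p q tautology = false≢true (tautology (λ _ → false))
  where
  false≢true : false ≢ true
  false≢true ()

mainTheorem4 : (p q : ℕ) → p ≢ q →
    ¬ EpsteinComplete 𝓕⟨ var p ⇒ (var q ↬ var p) ⟩
mainTheorem4 p q _ (X , complete) = ¬tautologyᶜ-φ p q (𝓕-sound-ᶜ α-only 𝓕α⊢φ)
  where
  α φ : Formula
  α = var p ⇒ (var q ↬ var p)
  φ = (var q ⇒ var p) ⇒ (var q ↬ var p)

  α-only : ∀ {ψ} → ψ ≡ α → Tautologyᶜ ψ
  α-only refl = α-tautologyᶜ p q

  X⊨φ : X ⊨ˣ φ
  X⊨φ ℜ ℜ∈X = related⇒⊨ (var p) (var q) ℜ (⊨α⇒related ℜ (proj₁ (complete α) (hyp refl) ℜ ℜ∈X))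

  𝓕α⊢φ : 𝓕⟨ α ⟩ φ
  𝓕α⊢φ = proj₂ (complete φ) X⊨φ
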